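{- Let $G$ be a finite simple undirected graph and let $r,m\in\mathbb{N}$. Let $c\in\mathbb{N}$ be such that $\mathrm{wcol}_r(G)\leq c$, and let $A\subseteq V(G)$ be a set of size at least $(c+1)\cdot 2^m$. Then there exist a set $S\subseteq V(G)$ of size at most $c(c-1)$ and a set $B\subseteq A$ of size at least $m$ which is $r$-independent in $G-S$.
   Context: For a linear order $L$ of $V(G)$ and $v\in V(G)$, a vertex $u$ is weakly $r$-reachable from $v$ with respect to $L$ if there is a path of length at most $r$ (length = number of edges) connecting $u$ and $v$ such that $u$ is the $L$-minimum vertex of the path; $\mathrm{WReach}_r[G,L,v]$ denotes the set of such vertices (it contains $v$). The weak $r$-colouring number is $\mathrm{wcol}_r(G)=\min_{L}\max_{v\in V(G)}|\mathrm{WReach}_r[G,L,v]|$, the minimum over all linear orders $L$ of $V(G)$. A vertex set $B$ is $r$-independent in a graph $H$ if $B\subseteq V(H)$ and $\mathrm{dist}_H(a,b)>r$ for all distinct $a,b\in B$. $G-S$ denotes the graph obtained from $G$ by deleting the vertices of $S$. -}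

module Defs where

open import Data.Nat using (ℕ; zero; suc; _+_; _*_; _∸_; _^_; _≤_; _<_)
open import Data.Fin using (Fin)
open import Data.Fin.Subset using (Subset; _∈_; _∉_; _⊆_; ∣_∣)
open import Data.List using (List; []; _∷_; length)
open import Data.List.Relation.Unary.All using (All)
open import Data.List.Relation.Unary.Unique.Propositional using (Unique)
open import Data.Product using (Σ; ∃; _×_; _,_)
open import Relation.Nullary using (¬_; Dec)
open import Relation.Binary.PropositionalEquality using (_≡_; _≢_)
open import Function.Definitions using (Injective)

record Graph (n : ℕ) : Set₁ where
  field
    Adj     : Fin n → Fin n → Set
    adj?    : ∀ u v → Dec (Adj u v)
    symm    : ∀ {u v} → Adj u v → Adj v u
    irrefl  : ∀ {u} → ¬ Adj u u
open Graph public

module _ {n : ℕ} (G : Graph n) where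

  data Walk : Fin n → Fin n → ℕ → Set where
    here : ∀ v → Walk v v 0
    step : ∀ {u w v k} → Adj G u w → Walk w v k → Walk u v (suc k)

  vertices : ∀ {u v k} → Walk u v k → List (Fin n)
  vertices (here v)   = v ∷ []
  vertices (step {u = u} _ p) = u ∷ vertices p

  IsPath : ∀ {u v k} → Walk u v k → Set
  IsPath p = Unique (vertices p)

-- A linear order on Fin n, given by an injective rank function
-- (x <_L y iff rank x < rank y).
LinOrder : ℕ → Set
LinOrder n = Σ (Fin n → ℕ) (λ rank → Injective _≡_ _≡_ rank)

rank : ∀ {n} → LinOrder n → Fin n → ℕ
rank (f , _) = f

WReach : ∀ {n} → Graph n → LinOrder n → ℕ → Fin n → Fin n → Set
WReach G L r v u =
  Σ ℕ λ k → k ≤ r × Σ (Walk G u v k) λ p →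
    IsPath G p × All (λ x → rank L u ≤ rank L x) (vertices G p)

AtMost : ∀ {n} → ℕ → (Fin n → Set) → Set
AtMost {n} c P = ∀ (xs : List (Fin n)) → Unique xs → All P xs → length xs ≤ c

-- wcol_r(G) ≤ c  (wcol_r is a minimum over linear orders of a maximum
-- over vertices, so this unfolds to the existence of a good order).
WcolAtMost : ∀ {n} → Graph n → ℕ → ℕ → Set
WcolAtMost G r c = Σ (LinOrder _) λ L → ∀ v → AtMost c (WReach G L r v)

RIndependentMinus : ∀ {n} → Graph n → ℕ → Subset n → Subset n → Set
RIndependentMinus G r S B =
  (∀ {x} → x ∈ B → x ∉ S) ×
  (∀ {a b} → a ∈ B → b ∈ B → a ≢ b →
     ∀ k → k ≤ r → (p : Walk G a b k) → IsPath G p →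
       ¬ All (λ x → x ∉ S) (vertices G p))

-- Write X v for WReach_r[G,L,v]: v ∈ X v, |X v| ≤ c, and X v lies L-below v. On a path of
-- length ≤ r between a and b, the L-least vertex lies in X a ∩ X b; so it suffices to find
-- B ⊆ A and S disjoint from B with X a ∩ X b ⊆ S for all distinct a, b ∈ B.
-- Greedily take the L-largest candidate b, discard the at most c candidates in X b, and split
-- the rest according to whether their reach set meets X b outside S. If the candidates that
-- do form the larger half, add X b − b (at most c − 1 vertices) to S: each of them then sees
-- one more vertex of S, and since b sees its t vertices of S and itself inside X b, S grows
-- at most c times, so |S| ≤ c(c − 1). Otherwise keep S, which already contains X a ∩ X b for
-- the other half. Each round keeps half of what is left after discarding c candidates, so
-- c(2^m − 1) candidates suffice.
module Submission where

open import Defs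
open import Data.Fin using (Fin; zero; suc; _≟_)
open import Data.Fin.Properties using (any?; suc-injective)
open import Data.Fin.Subset
  using (Subset; inside; outside; _∈_; _∉_; _⊆_; _⊂_; _∩_; _∪_; ∁; ⁅_⁆; ∣_∣; Nonempty)
  renaming (⊥ to ∅)
open import Data.Fin.Subset.Properties
  using ( _∈?_; nonempty?; Empty-unique; ∉⊥; ⊥⊆; ∣⊥∣≡0; ∣p∣≤∣x∷p∣; x∈⁅x⁆; x∈⁅y⁆⇒x≡y; x≢y⇒x∉⁅y⁆
        ; p⊂q⇒∣p∣<∣q∣; x∈∁p⇒x∉p; x∉p⇒x∈∁p; p∩q⊆p; p∩q⊆q; x∈p∩q⁺; x∈p∩q⁻; ∣p∩q∣≤∣q∣
        ; q⊆p∪q; x∈p∪q⁺; x∈p∪q⁻ )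
open import Data.List as List using (List; []; _∷_; _∷ʳ_; length)
import Data.List.Extrema.Nat as Extrema
open import Data.List.Properties using (length-map; unfold-reverse)
open import Data.List.Relation.Unary.All as All using (All; []; _∷_)
import Data.List.Relation.Unary.All.Properties as All
open import Data.List.Relation.Unary.Any using (here; there)
import Data.List.Relation.Unary.Any.Properties as Any
open import Data.List.Relation.Binary.Subset.Propositional using () renaming (_⊆_ to _⊆ₗ_)
open import Data.List.Relation.Unary.AllPairs using ([]; _∷_)
open import Data.List.Relation.Unary.Unique.Propositional using (Unique)
import Data.List.Relation.Unary.Unique.Propositional.Properties as Unique
open import Data.List.Membership.Propositional using () renaming (_∈_ to _∈ₗ_)
open import Data.List.Membership.Propositional.Properties using (∈-map⁺; ∈-map⁻)
open import Data.Nat using (ℕ; zero; suc; _+_; _*_; _∸_; _^_; _≤_; _<_; z≤n; s≤s; s≤s⁻¹)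
open import Data.Nat.Properties
  using ( ≤-refl; ≤-reflexive; ≤-trans; ≤-antisym; ≤-pred; _≤?_; m≤m+n; m≤n+m; m≤n⇒m≤1+n
        ; ≰⇒>; ≮⇒≥; <⇒≱; >⇒≢; +-suc; +-mono-≤; +-monoˡ-≤; +-monoʳ-≤; +-mono-<; +-cancelˡ-≤
        ; *-suc; *-comm; *-identityʳ; *-monoʳ-≤; m^n>0; anyUpTo?; module ≤-Reasoning )
open import Data.Product using (Σ; ∃; ∃-syntax; _×_; _,_; proj₁; proj₂)
open import Data.Sum as Sum using (_⊎_; inj₁; inj₂)
open import Data.Vec as Vec using ([]; _∷_; tabulate)
open import Data.Vec.Properties using (lookup∘tabulate; []=⇒lookup; lookup⇒[]=)
open import Function using (_∘_; id)
open import Relation.Nullary using (Dec; yes; no; does; ¬?; contradiction)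
import Relation.Nullary.Decidable as Dec
open import Relation.Nullary.Decidable using (dec-true; _×-dec_)
open import Relation.Unary using (Pred; Decidable)
open import Relation.Binary.PropositionalEquality
  using (_≡_; _≢_; refl; sym; trans; cong; cong₂; subst; module ≡-Reasoning)
open import Data.Nat.Tactic.RingSolver using (solve-∀)

private variable
  n : ℕ

module _ {p} {P : Pred (Fin n) p} (P? : Decidable P) where

  subsetOf : Subset n
  subsetOf = tabulate (does ∘ P?)

  ∈-subsetOf⁺ : ∀ {x} → P x → x ∈ subsetOf
  ∈-subsetOf⁺ {x} px = lookup⇒[]= x _ (trans (lookup∘tabulate _ x) (dec-true (P? x) px))

  ∈-subsetOf⁻ : ∀ {x} → x ∈ subsetOf → P x
  ∈-subsetOf⁻ {x} x∈ with P? x | trans (sym (lookup∘tabulate (does ∘ P?) x)) ([]=⇒lookup x∈)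
  ... | yes px | _ = px
  ... | no _   | ()

toList : Subset n → List (Fin n)
toList []            = []
toList (inside  ∷ p) = zero ∷ List.map suc (toList p)
toList (outside ∷ p) = List.map suc (toList p)

length-toList : (p : Subset n) → length (toList p) ≡ ∣ p ∣
length-toList []            = refl
length-toList (inside  ∷ p) = cong suc (trans (length-map suc (toList p)) (length-toList p))
length-toList (outside ∷ p) = trans (length-map suc (toList p)) (length-toList p)

toList-Unique : (p : Subset n) → Unique (toList p)
toList-Unique []            = []
toList-Unique (inside  ∷ p) =
  All.map⁺ (All.universal (λ _ ()) (toList p)) ∷ Unique.map⁺ suc-injective (toList-Unique p)
toList-Unique (outside ∷ p) = Unique.map⁺ suc-injective (toList-Unique p)

∈-toList⁺ : ∀ {p : Subset n} {x} → x ∈ p → x ∈ₗ toList p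
∈-toList⁺ {p = inside  ∷ p} Vec.here        = here refl
∈-toList⁺ {p = inside  ∷ p} (Vec.there x∈p) = there (∈-map⁺ suc (∈-toList⁺ x∈p))
∈-toList⁺ {p = outside ∷ p} (Vec.there x∈p) = ∈-map⁺ suc (∈-toList⁺ x∈p)

∈-toList⁻ : ∀ (p : Subset n) {x} → x ∈ₗ toList p → x ∈ p
∈-toList⁻ (inside  ∷ p) (here refl) = Vec.here
∈-toList⁻ (inside  ∷ p) (there x∈)  with _ , y∈ , refl ← ∈-map⁻ suc x∈ = Vec.there (∈-toList⁻ p y∈)
∈-toList⁻ (outside ∷ p) x∈          with _ , y∈ , refl ← ∈-map⁻ suc x∈ = Vec.there (∈-toList⁻ p y∈)

AtMost⇒∣∣≤ : ∀ {c} {P : Fin n → Set} → AtMost c P → (p : Subset n) → (∀ {x} → x ∈ p → P x) → ∣ p ∣ ≤ c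
AtMost⇒∣∣≤ atMost p p⊆P = subst (_≤ _) (length-toList p)
  (atMost (toList p) (toList-Unique p) (All.tabulate (p⊆P ∘ ∈-toList⁻ p)))

∣p∣≡∣p∩q∣+∣p∩∁q∣ : ∀ (p q : Subset n) → ∣ p ∣ ≡ ∣ p ∩ q ∣ + ∣ p ∩ ∁ q ∣
∣p∣≡∣p∩q∣+∣p∩∁q∣ []            []            = refl
∣p∣≡∣p∩q∣+∣p∩∁q∣ (outside ∷ p) (_ ∷ q)       = ∣p∣≡∣p∩q∣+∣p∩∁q∣ p q
∣p∣≡∣p∩q∣+∣p∩∁q∣ (inside  ∷ p) (inside  ∷ q) = cong suc (∣p∣≡∣p∩q∣+∣p∩∁q∣ p q)
∣p∣≡∣p∩q∣+∣p∩∁q∣ (inside  ∷ p) (outside ∷ q) =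
  trans (cong suc (∣p∣≡∣p∩q∣+∣p∩∁q∣ p q)) (sym (+-suc _ _))

∣p∪q∣≤∣p∣+∣q∣ : ∀ (p q : Subset n) → ∣ p ∪ q ∣ ≤ ∣ p ∣ + ∣ q ∣
∣p∪q∣≤∣p∣+∣q∣ []            []            = z≤n
∣p∪q∣≤∣p∣+∣q∣ (inside  ∷ p) (s ∷ q)       =
  s≤s (≤-trans (∣p∪q∣≤∣p∣+∣q∣ p q) (+-monoʳ-≤ ∣ p ∣ (∣p∣≤∣x∷p∣ s q)))
∣p∪q∣≤∣p∣+∣q∣ (outside ∷ p) (inside  ∷ q) =
  ≤-trans (s≤s (∣p∪q∣≤∣p∣+∣q∣ p q)) (≤-reflexive (sym (+-suc _ _)))
∣p∪q∣≤∣p∣+∣q∣ (outside ∷ p) (outside ∷ q) = ∣p∪q∣≤∣p∣+∣q∣ p q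

∣p∣>0⇒Nonempty : ∀ {p : Subset n} → 0 < ∣ p ∣ → Nonempty p
∣p∣>0⇒Nonempty {n} {p} 0<∣p∣ with nonempty? p
... | yes ne   = ne
... | no empty = contradiction (trans (cong ∣_∣ (Empty-unique empty)) (∣⊥∣≡0 n)) (>⇒≢ 0<∣p∣)

∃-argmax : (f : Fin n → ℕ) {p : Subset n} → Nonempty p →
           ∃[ x ] x ∈ p × (∀ {y} → y ∈ p → f y ≤ f x)
∃-argmax f {p} (x₀ , x₀∈p) =
  Extrema.argmax f x₀ (toList p) ,
  Extrema.argmax-all f x₀∈p (All.tabulate (∈-toList⁻ p)) ,
  λ y∈p → All.lookup (Extrema.f[xs]≤f[argmax] x₀ (toList p)) (∈-toList⁺ y∈p)

m+m≤x+y⇒m≤x⊎m≤y : ∀ {m} x y → m + m ≤ x + y → m ≤ x ⊎ m ≤ y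
m+m≤x+y⇒m≤x⊎m≤y {m} x y m+m≤x+y with m ≤? x
... | yes m≤x = inj₁ m≤x
... | no  m≰x = inj₂ (≮⇒≥ λ y<m → <⇒≱ (+-mono-< (≰⇒> m≰x) y<m) m+m≤x+y)

module Separation {n} (L : LinOrder n) (X : Fin n → Subset n)
  (X-refl : ∀ a → a ∈ X a) (X-rank : ∀ {a u} → u ∈ X a → rank L u ≤ rank L a)
  (k : ℕ) (∣X∣≤ : ∀ a → ∣ X a ∣ ≤ suc k) where

  Separated : Subset n → Subset n → Set
  Separated B S = ∀ {a b u} → a ∈ B → b ∈ B → a ≢ b → u ∈ X a → u ∈ X b → u ∈ S

  X⁻ : Fin n → Subset n
  X⁻ b = X b ∩ ∁ ⁅ b ⁆

  b∉X⁻b : ∀ b → b ∉ X⁻ b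
  b∉X⁻b b b∈ = x∈∁p⇒x∉p (p∩q⊆q (X b) _ b∈) (x∈⁅x⁆ b)

  ∣X⁻∣≤ : ∀ b → ∣ X⁻ b ∣ ≤ k
  ∣X⁻∣≤ b = ≤-pred (≤-trans (p⊂q⇒∣p∣<∣q∣ (p∩q⊆p _ _ , b , X-refl b , b∉X⁻b b)) (∣X∣≤ b))

  Rest : Subset n → Fin n → Subset n
  Rest F b = F ∩ ∁ (X b)

  fresh? : ∀ b S → Decidable (λ a → Nonempty (X a ∩ X b ∩ ∁ S))
  fresh? b S a = nonempty? (X a ∩ X b ∩ ∁ S)

  Fresh : Fin n → Subset n → Subset n
  Fresh b S = subsetOf (fresh? b S)

  Top : Subset n → Fin n → Set
  Top F b = b ∈ F × ∀ {a} → a ∈ F → b ∈ X a → a ≡ b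

  ∃-top : ∀ {F} → Nonempty F → ∃ (Top F)
  ∃-top F≢∅ with b , b∈F , max ← ∃-argmax (rank L) F≢∅ =
    b , b∈F , λ a∈F b∈Xa → proj₂ L (≤-antisym (max a∈F) (X-rank b∈Xa))

  module _ {F b} (top : Top F b) where

    top-unreachable : ∀ {a} → a ∈ Rest F b → b ∉ X a
    top-unreachable a∈ b∈Xa with a∈F , a∉Xb ← x∈p∩q⁻ F _ a∈ =
      x∈∁p⇒x∉p a∉Xb (subst (_∈ X b) (sym (proj₂ top a∈F b∈Xa)) (X-refl b))

    shared∈X⁻ : ∀ {a u} → a ∈ Rest F b → u ∈ X a → u ∈ X b → u ∈ X⁻ b
    shared∈X⁻ a∈ u∈Xa u∈Xb =
      x∈p∩q⁺ (u∈Xb , x∉p⇒x∈∁p (x≢y⇒x∉⁅y⁆ λ { refl → top-unreachable a∈ u∈Xa }))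

    fresh⇒X∩S⊂ : ∀ {S a} → a ∈ Rest F b ∩ Fresh b S → X a ∩ S ⊂ X a ∩ (X⁻ b ∪ S)
    fresh⇒X∩S⊂ {S} {a} a∈ with w , w∈ ← ∈-subsetOf⁻ (fresh? b S) (p∩q⊆q _ _ a∈)
      with w∈Xa , w∈Xb∩∁S ← x∈p∩q⁻ (X a) _ w∈
      with w∈Xb , w∉S ← x∈p∩q⁻ (X b) _ w∈Xb∩∁S =
      (λ u∈ → let u∈Xa , u∈S = x∈p∩q⁻ (X a) S u∈ in x∈p∩q⁺ (u∈Xa , x∈p∪q⁺ (inj₂ u∈S))) ,
      w , x∈p∩q⁺ (w∈Xa , x∈p∪q⁺ (inj₁ (shared∈X⁻ (p∩q⊆p _ _ a∈) w∈Xa w∈Xb))) ,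
      x∈∁p⇒x∉p w∉S ∘ p∩q⊆q (X a) S

  stale⇒shared∈S : ∀ {F S b a u} → a ∈ Rest F b ∩ ∁ (Fresh b S) → u ∈ X a → u ∈ X b → u ∈ S
  stale⇒shared∈S {S = S} {b} {u = u} a∈ u∈Xa u∈Xb with u ∈? S
  ... | yes u∈S = u∈S
  ... | no  u∉S = contradiction
    (∈-subsetOf⁺ (fresh? b S) (u , x∈p∩q⁺ (u∈Xa , x∈p∩q⁺ (u∈Xb , x∉p⇒x∈∁p u∉S))))
    (x∈∁p⇒x∉p (p∩q⊆q _ _ a∈))

  -- S′-origin keeps earlier picks out of S′: later additions are reached from remaining
  -- candidates, which never reach an earlier pick.
  record Selection (m : ℕ) (F S : Subset n) : Set where
    field
      B S′      : Subset n
      B⊆F       : B ⊆ F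
      m≤∣B∣     : m ≤ ∣ B ∣
      ∣S′∣≤     : ∣ S′ ∣ ≤ k * suc k
      B-avoids  : ∀ {x} → x ∈ B → x ∉ S′
      separated : Separated B S′
      S⊆S′      : S ⊆ S′
      S′-origin : ∀ {u} → u ∈ S′ → u ∈ S ⊎ ∃[ a ] a ∈ F × u ∈ X a

  extend : ∀ {m F S F′ S₁ b} → Top F b → F′ ⊆ Rest F b →
           S ⊆ S₁ → (∀ {u} → u ∈ S₁ → u ∈ X b ⊎ u ∈ S) → b ∉ S₁ →
           (∀ {a u} → a ∈ F′ → u ∈ X a → u ∈ X b → u ∈ S₁) →
           Selection m F′ S₁ → Selection (suc m) F S
  extend {F = F} {S} {F′} {S₁} {b} top F′⊆ S⊆S₁ S₁-origin b∉S₁ shared sel = record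
    { B = ⁅ b ⁆ ∪ B ; S′ = S′ ; B⊆F = B⁺⊆F ; m≤∣B∣ = ≤-trans (s≤s m≤∣B∣) (p⊂q⇒∣p∣<∣q∣ B⊂B⁺)
    ; ∣S′∣≤ = ∣S′∣≤ ; B-avoids = B⁺-avoids ; separated = separated⁺
    ; S⊆S′ = S⊆S′ ∘ S⊆S₁ ; S′-origin = origin }
    where
    open Selection sel
    F′⊆F : F′ ⊆ F
    F′⊆F = p∩q⊆p F _ ∘ F′⊆
    B⊂B⁺ : B ⊂ ⁅ b ⁆ ∪ B
    B⊂B⁺ = q⊆p∪q ⁅ b ⁆ B , b , x∈p∪q⁺ (inj₁ (x∈⁅x⁆ b)) ,
           λ b∈B → x∈∁p⇒x∉p (p∩q⊆q F _ (F′⊆ (B⊆F b∈B))) (X-refl b)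
    b∉S′ : b ∉ S′
    b∉S′ b∈S′ with S′-origin b∈S′
    ... | inj₁ b∈S₁              = b∉S₁ b∈S₁
    ... | inj₂ (a , a∈F′ , b∈Xa) = top-unreachable top (F′⊆ a∈F′) b∈Xa
    B⁺⊆F : ⁅ b ⁆ ∪ B ⊆ F
    B⁺⊆F x∈ with x∈p∪q⁻ ⁅ b ⁆ B x∈
    ... | inj₁ x∈⁅b⁆ rewrite x∈⁅y⁆⇒x≡y b x∈⁅b⁆ = proj₁ top
    ... | inj₂ x∈B = F′⊆F (B⊆F x∈B)
    B⁺-avoids : ∀ {x} → x ∈ ⁅ b ⁆ ∪ B → x ∉ S′
    B⁺-avoids x∈ with x∈p∪q⁻ ⁅ b ⁆ B x∈
    ... | inj₁ x∈⁅b⁆ rewrite x∈⁅y⁆⇒x≡y b x∈⁅b⁆ = b∉S′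
    ... | inj₂ x∈B = B-avoids x∈B
    separated⁺ : Separated (⁅ b ⁆ ∪ B) S′
    separated⁺ a∈ a′∈ a≢a′ u∈Xa u∈Xa′ with x∈p∪q⁻ ⁅ b ⁆ B a∈ | x∈p∪q⁻ ⁅ b ⁆ B a′∈
    ... | inj₁ a∈⁅b⁆ | inj₁ a′∈⁅b⁆ =
      contradiction (trans (x∈⁅y⁆⇒x≡y b a∈⁅b⁆) (sym (x∈⁅y⁆⇒x≡y b a′∈⁅b⁆))) a≢a′
    ... | inj₁ a∈⁅b⁆ | inj₂ a′∈B rewrite x∈⁅y⁆⇒x≡y b a∈⁅b⁆ = S⊆S′ (shared (B⊆F a′∈B) u∈Xa′ u∈Xa)
    ... | inj₂ a∈B | inj₁ a′∈⁅b⁆ rewrite x∈⁅y⁆⇒x≡y b a′∈⁅b⁆ = S⊆S′ (shared (B⊆F a∈B) u∈Xa u∈Xa′)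
    ... | inj₂ a∈B | inj₂ a′∈B = separated a∈B a′∈B a≢a′ u∈Xa u∈Xa′
    origin : ∀ {u} → u ∈ S′ → u ∈ S ⊎ ∃[ a ] a ∈ F × u ∈ X a
    origin u∈S′ with S′-origin u∈S′
    ... | inj₂ (a , a∈F′ , u∈Xa) = inj₂ (a , F′⊆F a∈F′ , u∈Xa)
    ... | inj₁ u∈S₁ with S₁-origin u∈S₁
    ...   | inj₁ u∈Xb = inj₂ (b , proj₁ top , u∈Xb)
    ...   | inj₂ u∈S  = inj₁ u∈S

  -- t is the number of times S has grown so far.
  record Invariant (F S : Subset n) (t : ℕ) : Set where
    field
      F-avoids : ∀ {x} → x ∈ F → x ∉ S
      ∣S∣≤     : ∣ S ∣ ≤ k * t
      t≤c      : t ≤ suc k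
      t≤∣X∩S∣  : ∀ {a} → a ∈ F → t ≤ ∣ X a ∩ S ∣

  Invariant-⊆ : ∀ {F′ F S t} → F′ ⊆ F → Invariant F S t → Invariant F′ S t
  Invariant-⊆ F′⊆F inv = record
    { F-avoids = F-avoids ∘ F′⊆F ; ∣S∣≤ = ∣S∣≤ ; t≤c = t≤c ; t≤∣X∩S∣ = t≤∣X∩S∣ ∘ F′⊆F }
    where open Invariant inv

  Invariant-grow : ∀ {F S t b} → Top F b → Invariant F S t →
                   Invariant (Rest F b ∩ Fresh b S) (X⁻ b ∪ S) (suc t)
  Invariant-grow {F} {S} {t} {b} top inv = record
    { F-avoids = F₁-avoids
    ; ∣S∣≤     = ≤-trans (∣p∪q∣≤∣p∣+∣q∣ (X⁻ b) S)
                   (≤-trans (+-mono-≤ (∣X⁻∣≤ b) ∣S∣≤) (≤-reflexive (sym (*-suc k t))))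
    ; t≤c      = ≤-trans (s≤s (t≤∣X∩S∣ (proj₁ top))) (≤-trans (p⊂q⇒∣p∣<∣q∣ X-b∩S⊂X-b) (∣X∣≤ b))
    ; t≤∣X∩S∣  = λ a∈ → ≤-trans (s≤s (t≤∣X∩S∣ (F₁⊆F a∈))) (p⊂q⇒∣p∣<∣q∣ (fresh⇒X∩S⊂ top a∈)) }
    where
    open Invariant inv
    F₁⊆F : Rest F b ∩ Fresh b S ⊆ F
    F₁⊆F = p∩q⊆p F _ ∘ p∩q⊆p _ _
    X-b∩S⊂X-b : X b ∩ S ⊂ X b
    X-b∩S⊂X-b = p∩q⊆p _ _ , b , X-refl b , F-avoids (proj₁ top) ∘ p∩q⊆q (X b) S
    F₁-avoids : ∀ {a} → a ∈ Rest F b ∩ Fresh b S → a ∉ X⁻ b ∪ S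
    F₁-avoids a∈ a∈S₁ with x∈p∪q⁻ (X⁻ b) S a∈S₁
    ... | inj₁ a∈X⁻ = x∈∁p⇒x∉p (p∩q⊆q F _ (p∩q⊆p _ _ a∈)) (p∩q⊆p _ _ a∈X⁻)
    ... | inj₂ a∈S  = F-avoids (F₁⊆F a∈) a∈S

  threshold : ℕ → ℕ
  threshold zero    = 0
  threshold (suc m) = suc k + (threshold m + threshold m)

  threshold+c≡c*2^m : ∀ m → threshold m + suc k ≡ suc k * 2 ^ m
  threshold+c≡c*2^m zero    = sym (*-identityʳ (suc k))
  threshold+c≡c*2^m (suc m) = begin
    suc k + (threshold m + threshold m) + suc k    ≡⟨ regroup (suc k) (threshold m) ⟩
    (threshold m + suc k) + (threshold m + suc k)  ≡⟨ cong₂ _+_ ih ih ⟩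
    suc k * 2 ^ m + suc k * 2 ^ m                  ≡⟨ double (suc k) (2 ^ m) ⟩
    suc k * 2 ^ suc m                              ∎
    where
    open ≡-Reasoning
    ih = threshold+c≡c*2^m m
    regroup : ∀ c t → c + (t + t) + c ≡ (t + c) + (t + c)
    regroup = solve-∀
    double : ∀ c p → c * p + c * p ≡ c * (2 * p)
    double = solve-∀

  threshold-split : ∀ m {F} S b → threshold (suc m) ≤ ∣ F ∣ →
    threshold m ≤ ∣ Rest F b ∩ Fresh b S ∣ ⊎ threshold m ≤ ∣ Rest F b ∩ ∁ (Fresh b S) ∣
  threshold-split m {F} S b big = m+m≤x+y⇒m≤x⊎m≤y _ _ (+-cancelˡ-≤ (suc k) _ _ (begin
    suc k + (threshold m + threshold m)       ≤⟨ big ⟩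
    ∣ F ∣                                     ≡⟨ ∣p∣≡∣p∩q∣+∣p∩∁q∣ F (X b) ⟩
    ∣ F ∩ X b ∣ + ∣ R ∣                       ≤⟨ +-monoˡ-≤ ∣ R ∣ (≤-trans (∣p∩q∣≤∣q∣ F (X b)) (∣X∣≤ b)) ⟩
    suc k + ∣ R ∣                             ≡⟨ cong (suc k +_) (∣p∣≡∣p∩q∣+∣p∩∁q∣ R (Fresh b S)) ⟩
    suc k + (∣ R ∩ Fresh b S ∣ + ∣ R ∩ ∁ (Fresh b S) ∣) ∎))
    where
    open ≤-Reasoning
    R = Rest F b

  select : ∀ m {F S t} → Invariant F S t → threshold m ≤ ∣ F ∣ → Selection m F S
  select zero {S = S} inv _ = record
    { B = ∅ ; S′ = S ; B⊆F = ⊥⊆ ; m≤∣B∣ = z≤n ; ∣S′∣≤ = ≤-trans ∣S∣≤ (*-monoʳ-≤ k t≤c)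
    ; B-avoids = λ x∈∅ → contradiction x∈∅ ∉⊥ ; separated = λ a∈∅ → contradiction a∈∅ ∉⊥
    ; S⊆S′ = id ; S′-origin = inj₁ }
    where open Invariant inv
  select (suc m) {F} {S} inv big
    with b , top ← ∃-top (∣p∣>0⇒Nonempty (≤-trans (s≤s z≤n) (≤-trans (m≤m+n (suc k) _) big)))
    with threshold-split m {F} S b big
  ... | inj₁ big₁ = extend {F = F} top (p∩q⊆p _ _) (q⊆p∪q (X⁻ b) S)
      (Sum.map₁ (p∩q⊆p _ _) ∘ x∈p∪q⁻ (X⁻ b) S)
      (Sum.[ b∉X⁻b b , Invariant.F-avoids inv (proj₁ top) ] ∘ x∈p∪q⁻ (X⁻ b) S)
      (λ a∈ u∈Xa u∈Xb → x∈p∪q⁺ (inj₁ (shared∈X⁻ top (p∩q⊆p _ _ a∈) u∈Xa u∈Xb)))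
      (select m (Invariant-grow {F} top inv) big₁)
  ... | inj₂ big₀ = extend {F = F} top (p∩q⊆p _ _) id inj₂ (Invariant.F-avoids inv (proj₁ top))
      stale⇒shared∈S (select m (Invariant-⊆ (p∩q⊆p F _ ∘ p∩q⊆p _ _) inv) big₀)

  separation : ∀ m (A : Subset n) → threshold m ≤ ∣ A ∣ →
    ∃[ S ] ∃[ B ] ∣ S ∣ ≤ k * suc k × B ⊆ A × m ≤ ∣ B ∣ × (∀ {x} → x ∈ B → x ∉ S) × Separated B S
  separation m A big = S′ , B , ∣S′∣≤ , B⊆F , m≤∣B∣ , B-avoids , separated
    where
    initial : Invariant A ∅ 0
    initial = record
      { F-avoids = λ _ → ∉⊥ ; ∣S∣≤ = ≤-trans (≤-reflexive (∣⊥∣≡0 n)) z≤n ; t≤c = z≤n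
      ; t≤∣X∩S∣ = λ _ → z≤n }
    open Selection (select m initial big)

Unique-reverse : ∀ {A : Set} {xs : List A} → Unique xs → Unique (List.reverse xs)
Unique-reverse [] = []
Unique-reverse {xs = x ∷ xs} (x∉xs ∷ u) = subst Unique (sym (unfold-reverse x xs))
  (Unique.++⁺ (Unique-reverse u) ([] ∷ [])
    λ { (x∈ , here refl) → All.lookup x∉xs (Any.reverse⁻ x∈) refl })

module _ {n} (G : Graph n) where

  private variable
    u v w : Fin n
    k : ℕ

  first∈ : (p : Walk G u v k) → u ∈ₗ vertices G p
  first∈ (here _)   = here refl
  first∈ (step _ _) = here refl

  last∈ : (p : Walk G u v k) → v ∈ₗ vertices G p
  last∈ (here _)   = here refl
  last∈ (step _ p) = there (last∈ p)

  _▷_ : Walk G u v k → Adj G v w → Walk G u w (suc k)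
  here _   ▷ e = step e (here _)
  step d p ▷ e = step d (p ▷ e)

  vertices-▷ : (p : Walk G u v k) (e : Adj G v w) → vertices G (p ▷ e) ≡ vertices G p ∷ʳ w
  vertices-▷ (here _)   e = refl
  vertices-▷ (step d p) e = cong (_ ∷_) (vertices-▷ p e)

  reverse : Walk G u v k → Walk G v u k
  reverse (here v)   = here v
  reverse (step e p) = reverse p ▷ symm G e

  vertices-reverse : (p : Walk G u v k) → vertices G (reverse p) ≡ List.reverse (vertices G p)
  vertices-reverse (here _)   = refl
  vertices-reverse (step {u = u} e p) = begin
    vertices G (reverse p ▷ symm G e)  ≡⟨ vertices-▷ (reverse p) (symm G e) ⟩
    vertices G (reverse p) ∷ʳ u        ≡⟨ cong (_∷ʳ u) (vertices-reverse p) ⟩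
    List.reverse (vertices G p) ∷ʳ u   ≡⟨ unfold-reverse u (vertices G p) ⟨
    List.reverse (u ∷ vertices G p)    ∎
    where open ≡-Reasoning

  ∈-reverse⁺ : (p : Walk G u v k) → w ∈ₗ vertices G p → w ∈ₗ vertices G (reverse p)
  ∈-reverse⁺ p w∈ = subst (_ ∈ₗ_) (sym (vertices-reverse p)) (Any.reverse⁺ w∈)

  ∈-reverse⁻ : (p : Walk G u v k) → w ∈ₗ vertices G (reverse p) → w ∈ₗ vertices G p
  ∈-reverse⁻ p w∈ = Any.reverse⁻ (subst (_ ∈ₗ_) (vertices-reverse p) w∈)

  reverse-IsPath : (p : Walk G u v k) → IsPath G p → IsPath G (reverse p)
  reverse-IsPath p = subst Unique (sym (vertices-reverse p)) ∘ Unique-reverse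

  suffix : (p : Walk G u v k) → w ∈ₗ vertices G p →
           ∃[ j ] j ≤ k × Σ (Walk G w v j) λ q →
             (IsPath G p → IsPath G q) × vertices G q ⊆ₗ vertices G p
  suffix p@(here _)   (here refl) = _ , ≤-refl , p , id , id
  suffix p@(step _ _) (here refl) = _ , ≤-refl , p , id , id
  suffix (step e p) (there w∈)  with j , j≤k , q , path , q⊆p ← suffix p w∈ =
    j , m≤n⇒m≤1+n j≤k , q , (λ { (_ ∷ p-path) → path p-path }) , there ∘ q⊆p

  module _ (v : Fin n) where

    ConstrainedPath : ∀ {q} → Pred (Fin n) q → ℕ → Fin n → Set q
    ConstrainedPath Q k x = Σ (Walk G x v k) λ p → IsPath G p × All Q (vertices G p)

    -- The tail of a path from x must avoid x; this is folded into the constraint.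
    constrainedPath? : ∀ {q} {Q : Pred (Fin n) q} → Decidable Q → ∀ k x → Dec (ConstrainedPath Q k x)
    constrainedPath? Q? zero x with x ≟ v | Q? x
    ... | yes refl | yes qx = yes (here x , [] ∷ [] , qx ∷ [])
    ... | yes refl | no ¬qx = no λ { (here _ , _ , qx ∷ []) → ¬qx qx }
    ... | no  x≢v  | _      = no λ { (here _ , _) → x≢v refl }
    constrainedPath? Q? (suc k) x
      with Q? x | any? (λ w → adj? G x w ×-dec constrainedPath? (λ y → Q? y ×-dec ¬? (x ≟ y)) k w)
    ... | no ¬qx | _ = no λ { (step _ _ , _ , qx ∷ _) → ¬qx qx }
    ... | yes qx | yes (_ , e , p , p-path , Q∩x≢) =
      yes (step e p , All.map proj₂ Q∩x≢ ∷ p-path , qx ∷ All.map proj₁ Q∩x≢)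
    ... | yes qx | no ¬extend = no λ { (step e p , x∉p ∷ p-path , _ ∷ Qp) →
      ¬extend (_ , e , p , p-path , All.zip (Qp , x∉p)) }

  module _ (L : LinOrder n) (r : ℕ) where

    WReach-refl : ∀ v → WReach G L r v v
    WReach-refl v = 0 , z≤n , here v , [] ∷ [] , ≤-refl ∷ []

    WReach-rank : WReach G L r v u → rank L u ≤ rank L v
    WReach-rank (_ , _ , p , _ , u≤p) = All.lookup u≤p (last∈ p)

    WReach? : ∀ v u → Dec (WReach G L r v u)
    WReach? v u = Dec.map′ (λ (k , k<1+r , path) → k , s≤s⁻¹ k<1+r , path)
                           (λ (k , k≤r , path) → k , s≤s k≤r , path)
      (anyUpTo? (λ k → constrainedPath? v (λ x → rank L u ≤? rank L x) k u) (suc r))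

    reach : Fin n → Subset n
    reach v = subsetOf (WReach? v)

    reach-refl : ∀ v → v ∈ reach v
    reach-refl v = ∈-subsetOf⁺ (WReach? v) (WReach-refl v)

    reach-rank : u ∈ reach v → rank L u ≤ rank L v
    reach-rank {v = v} = WReach-rank ∘ ∈-subsetOf⁻ (WReach? v)

    ∣reach∣≤ : ∀ {c} v → AtMost c (WReach G L r v) → ∣ reach v ∣ ≤ c
    ∣reach∣≤ v atMost = AtMost⇒∣∣≤ atMost (reach v) (∈-subsetOf⁻ (WReach? v))

    path-meets-reach : k ≤ r → (p : Walk G u v k) → IsPath G p →
      ∃[ w ] w ∈ₗ vertices G p × w ∈ reach u × w ∈ reach v
    path-meets-reach {k} {u} k≤r p p-path =
      lowest , lowest∈p ,
      via-suffix (reverse p) (∈-reverse⁺ p lowest∈p) (reverse-IsPath p p-path) (lowest≤p ∘ ∈-reverse⁻ p) ,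
      via-suffix p lowest∈p p-path lowest≤p
      where
      lowest = Extrema.argmin (rank L) u (vertices G p)
      lowest∈p : lowest ∈ₗ vertices G p
      lowest∈p = Extrema.argmin-all (rank L) (first∈ p) (All.tabulate id)
      lowest≤p : ∀ {x} → x ∈ₗ vertices G p → rank L lowest ≤ rank L x
      lowest≤p = All.lookup (Extrema.f[argmin]≤f[xs] u (vertices G p))
      via-suffix : ∀ {x y} (q : Walk G x y k) → lowest ∈ₗ vertices G q → IsPath G q →
                   (∀ {z} → z ∈ₗ vertices G q → rank L lowest ≤ rank L z) → lowest ∈ reach y
      via-suffix {y = y} q lowest∈q q-path lowest≤q with j , j≤k , q′ , path , q′⊆q ← suffix q lowest∈q =
        ∈-subsetOf⁺ (WReach? y) (j , ≤-trans j≤k k≤r , q′ , path q-path , All.tabulate (lowest≤q ∘ q′⊆q))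

    separated⇒RIndependentMinus : ∀ {S B} → (∀ {x} → x ∈ B → x ∉ S) →
      (∀ {a b w} → a ∈ B → b ∈ B → a ≢ b → w ∈ reach a → w ∈ reach b → w ∈ S) →
      RIndependentMinus G r S B
    separated⇒RIndependentMinus B-avoids separated =
      B-avoids , λ a∈B b∈B a≢b _ k≤r p p-path p-avoids →
        let w , w∈p , w∈reach-a , w∈reach-b = path-meets-reach k≤r p p-path
        in All.lookup p-avoids w∈p (separated a∈B b∈B a≢b w∈reach-a w∈reach-b)

theorem4 : ∀ {n} (G : Graph n) (r m c : ℕ) → WcolAtMost G r c →
  (A : Subset n) → suc c * 2 ^ m ≤ ∣ A ∣ →
  Σ (Subset n) λ S → Σ (Subset n) λ B →
    ∣ S ∣ ≤ c * (c ∸ 1) × B ⊆ A × m ≤ ∣ B ∣ × RIndependentMinus G r S B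
theorem4 G r m zero (L , wcol) A big
  with a , _ ← ∣p∣>0⇒Nonempty {p = A} (≤-trans (m^n>0 2 m) (≤-trans (m≤m+n (2 ^ m) 0) big)) =
  contradiction (wcol a (a ∷ []) ([] ∷ []) (WReach-refl G L r a ∷ [])) λ ()
theorem4 G r m (suc k) (L , wcol) A big =
  let S , B , ∣S∣≤ , B⊆A , m≤∣B∣ , B-avoids , separated = separation m A enough in
  S , B , ≤-trans ∣S∣≤ (≤-reflexive (*-comm k (suc k))) , B⊆A , m≤∣B∣ ,
  separated⇒RIndependentMinus G L r B-avoids separated
  where
  open Separation L (reach G L r) (reach-refl G L r) (reach-rank G L r) k (λ v → ∣reach∣≤ G L r v (wcol v))
  enough : threshold m ≤ ∣ A ∣
  enough = begin
    threshold m            ≤⟨ m≤m+n (threshold m) (suc k) ⟩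
    threshold m + suc k    ≡⟨ threshold+c≡c*2^m m ⟩
    suc k * 2 ^ m          ≤⟨ m≤n+m (suc k * 2 ^ m) (2 ^ m) ⟩
    suc (suc k) * 2 ^ m    ≤⟨ big ⟩
    ∣ A ∣                  ∎
    where open ≤-Reasoning
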